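{- Let $\mathcal{P}=(X,\prec)$ be a poset with $|X|=n$ and dimension at most $2$, and let $A\subsetneq X$ be an antichain of $\mathcal{P}$. Then the equivalence relation on $A$ given by $x\sim y \iff N(x)=N(y)$ has at most $2(n-|A|)$ equivalence classes.
   Context: A poset $\mathcal{P}=(X,\prec)$ has a finite ground set $X$ and an irreflexive, transitive relation $\prec$. Its dimension is the smallest $d$ such that there are total orders $<_1,\dots,<_d$ on $X$ with $x\prec y$ iff $x<_k y$ for all $k$. An antichain is a set of pairwise incomparable elements. The comparability graph $\mathcal{C}(\mathcal{P})$ has vertex set $X$ and edges $\{x,y\}$ whenever $x\prec y$ or $y\prec x$. For $x\in X$, $N(x)$ denotes the open neighborhood of $x$ in $\mathcal{C}(\mathcal{P})$, i.e. the set of elements of $X$ comparable with $x$. -}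

module Defs where

open import Level using (0ℓ)
open import Data.Nat using (ℕ; _≤_; _*_; _∸_)
open import Data.Fin using (Fin)
open import Data.Fin.Subset using (Subset; _∈_; _∉_; ∣_∣)
open import Data.Product using (_×_; ∃)
open import Data.Sum using (_⊎_)
open import Data.Empty using (⊥)
open import Relation.Nullary using (¬_)
open import Relation.Binary.Core using (Rel)
open import Relation.Binary.Definitions using (Irreflexive; Transitive)
open import Relation.Binary.Structures using (IsStrictTotalOrder)
open import Relation.Binary.PropositionalEquality using (_≡_)
open import Function.Bundles using (_⇔_)

record IsPoset {n : ℕ} (_≺_ : Rel (Fin n) 0ℓ) : Set where
  field
    irrefl : Irreflexive _≡_ _≺_
    trans  : Transitive _≺_

-- dimension at most 2: there are total orders <₁, <₂ on X with
-- x ≺ y iff (x <₁ y and x <₂ y).  (Dimension ≤ 2 with fewer orders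
-- can always be padded by repeating an order.)
DimAtMost2 : {n : ℕ} → Rel (Fin n) 0ℓ → Set₁
DimAtMost2 {n} _≺_ =
  ∃ λ (_<₁_ : Rel (Fin n) 0ℓ) → ∃ λ (_<₂_ : Rel (Fin n) 0ℓ) →
    IsStrictTotalOrder _≡_ _<₁_ × IsStrictTotalOrder _≡_ _<₂_ ×
    (∀ x y → (x ≺ y) ⇔ (x <₁ y × x <₂ y))

IsAntichain : {n : ℕ} → Rel (Fin n) 0ℓ → Subset n → Set
IsAntichain _≺_ A = ∀ x y → x ∈ A → y ∈ A → ¬ (x ≺ y)

InN : {n : ℕ} → Rel (Fin n) 0ℓ → Fin n → Fin n → Set
InN _≺_ x z = (z ≺ x) ⊎ (x ≺ z)

SameN : {n : ℕ} → Rel (Fin n) 0ℓ → Fin n → Fin n → Set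
SameN _≺_ x y = ∀ z → InN _≺_ x z ⇔ InN _≺_ y z

-- the relation ~ on A has at most k equivalence classes:
-- every family of pairwise inequivalent elements of A has size ≤ k
AtMostClasses : {n : ℕ} → (Fin n → Fin n → Set) → Subset n → ℕ → Set
AtMostClasses {n} _~_ A k =
  ∀ (m : ℕ) (r : Fin m → Fin n) →
    (∀ i → r i ∈ A) →
    (∀ i j → ¬ (i ≡ j) → ¬ (r i ~ r j)) →
    m ≤ k

{-# OPTIONS --safe #-}
-- Sort pairwise inequivalent a₁, …, aₘ ∈ A by the first linear order.  As A is an
-- antichain, the second order reverses the first on A, so each b ∉ A is comparable
-- with an interval of consecutive aᵢ.  Consecutive aᵢ, aᵢ₊₁ are separated by some b
-- whose interval ends at aᵢ or starts at aᵢ₊₁; charging the gap to that end or start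
-- charges each b at most twice.  The b separating a₁ from aₘ is comparable with one
-- of them.  For m = 1 this needs A ≠ X.
module Submission where

open import Defs
open import Level using (Level; 0ℓ)
open import Data.Nat using (ℕ; suc; _+_; _*_; _∸_; _≤_; _<_; _⊔_; z≤n; s≤s)
open import Data.Nat.Properties
  using ( ≤-trans; ≤-<-trans; +-mono-<-≤; +-mono-≤-<; +-identityʳ; m≤m⊔n; m≤n⊔m; ⊔-lub
        ; *-monoʳ-≤; m≤n*m; module ≤-Reasoning)
open import Data.Fin using (Fin)
open import Data.Fin.Properties using (any?)
open import Data.Fin.Subset using (Subset; _∈_; _∉_; _⊆_; ∣_∣; ∁; ⊥)
open import Data.Fin.Subset.Properties
  using (p⊆q⇒∣p∣≤∣q∣; p⊂q⇒∣p∣<∣q∣; ∣∁p∣≡n∸∣p∣; x∉p⇒x∈∁p; ∉⊥; ⊥⊆; ∣⊥∣≡0)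
open import Data.Vec using (tabulate)
open import Data.Vec.Properties using (lookup∘tabulate; []=⇒lookup; lookup⇒[]=)
open import Data.List as List using (List; []; _∷_; length)
open import Data.List.Properties using (length-tabulate)
open import Data.List.Membership.Propositional using (lose) renaming (_∈_ to _∈ₗ_)
open import Data.List.Relation.Unary.Any as Any using (Any; here; there)
open import Data.List.Relation.Unary.All as All using (All; []; _∷_)
import Data.List.Relation.Unary.All.Properties as All
open import Data.List.Relation.Unary.AllPairs using (AllPairs; []; _∷_)
import Data.List.Relation.Unary.AllPairs.Properties as AllPairs
open import Data.List.Relation.Unary.Linked as Linked using (Linked)
open import Data.List.Relation.Unary.Linked.Properties using (AllPairs⇒Linked; Linked⇒AllPairs)
open import Data.List.Relation.Binary.Permutation.Propositional using (↭-sym; ↭⇒↭ₛ)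
open import Data.List.Relation.Binary.Permutation.Propositional.Properties using (↭-length)
import Data.List.Relation.Binary.Permutation.Setoid.Properties as Perm
import Data.List.Sort
open import Data.Product using (_×_; _,_; proj₁; proj₂; ∃)
open import Data.Sum using (_⊎_; inj₁; inj₂)
open import Data.Empty using (⊥-elim)
open import Function using (_∘_; _⇔_; mk⇔; Equivalence)
open import Relation.Nullary using (¬_; Dec; does; proof)
open import Relation.Nullary.Reflects using (Reflects; invert)
open import Relation.Nullary.Decidable using (map′; ¬?; _×-dec_; _⊎-dec_; dec-true; decidable-stable)
open import Relation.Unary using (Pred; Decidable)
open import Relation.Binary.Core using (Rel)
open import Relation.Binary.Bundles using (DecTotalOrder)
open import Relation.Binary.Definitions using (Symmetric; tri<; tri≈; tri>)
open import Relation.Binary.Structures using (IsStrictTotalOrder; IsDecTotalOrder)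
import Relation.Binary.Construct.StrictToNonStrict as StrictToNonStrict
open import Relation.Binary.PropositionalEquality
  using (_≡_; _≢_; refl; sym; trans; cong; subst; subst₂; resp₂; setoid)

private
  variable
    n : ℕ
    ℓ : Level

toSubset : {P : Pred (Fin n) ℓ} → Decidable P → Subset n
toSubset P? = tabulate (does ∘ P?)

∈-toSubset⁺ : {P : Pred (Fin n) ℓ} (P? : Decidable P) → ∀ {x} → P x → x ∈ toSubset P?
∈-toSubset⁺ P? {x} px = lookup⇒[]= x _ (trans (lookup∘tabulate _ x) (dec-true (P? x) px))

∈-toSubset⁻ : {P : Pred (Fin n) ℓ} (P? : Decidable P) → ∀ {x} → x ∈ toSubset P? → P x
∈-toSubset⁻ {P = P} P? {x} x∈ =
  invert (subst (Reflects (P x)) (trans (sym (lookup∘tabulate _ x)) ([]=⇒lookup x∈)) (proof (P? x)))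

toSubset-⊆ : {P Q : Pred (Fin n) ℓ} (P? : Decidable P) (Q? : Decidable Q) →
             (∀ {x} → P x → Q x) → toSubset P? ⊆ toSubset Q?
toSubset-⊆ P? Q? P⇒Q x∈ = ∈-toSubset⁺ Q? (P⇒Q (∈-toSubset⁻ P? x∈))

∣toSubset∣-mono : {P Q : Pred (Fin n) ℓ} (P? : Decidable P) (Q? : Decidable Q) →
                  (∀ {x} → P x → Q x) → ∣ toSubset P? ∣ ≤ ∣ toSubset Q? ∣
∣toSubset∣-mono P? Q? P⇒Q = p⊆q⇒∣p∣≤∣q∣ (toSubset-⊆ P? Q? P⇒Q)

∣toSubset∣-mono-< : {P Q : Pred (Fin n) ℓ} (P? : Decidable P) (Q? : Decidable Q) →
                    (∀ {x} → P x → Q x) → ∀ x → Q x → ¬ P x → ∣ toSubset P? ∣ < ∣ toSubset Q? ∣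
∣toSubset∣-mono-< P? Q? P⇒Q x qx ¬px =
  p⊂q⇒∣p∣<∣q∣ (toSubset-⊆ P? Q? P⇒Q , x , ∈-toSubset⁺ Q? qx , ¬px ∘ ∈-toSubset⁻ P?)

x∉p⇒0<n∸∣p∣ : ∀ {n} {x : Fin n} {p} → x ∉ p → 0 < n ∸ ∣ p ∣
x∉p⇒0<n∸∣p∣ {n} {p = p} x∉p =
  subst₂ _<_ (∣⊥∣≡0 n) (∣∁p∣≡n∸∣p∣ p) (p⊂q⇒∣p∣<∣q∣ {p = ⊥} (⊥⊆ , _ , x∉p⇒x∈∁p x∉p , ∉⊥))

p⊆∁q⇒∣p∣≤n∸∣q∣ : ∀ {p q : Subset n} → p ⊆ ∁ q → ∣ p ∣ ≤ n ∸ ∣ q ∣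
p⊆∁q⇒∣p∣≤n∸∣q∣ {q = q} p⊆∁q = subst (_ ≤_) (∣∁p∣≡n∸∣p∣ q) (p⊆q⇒∣p∣≤∣q∣ p⊆∁q)

module _ {a ℓ₂ : Level} {X : Set a} {_≼_ : Rel X ℓ₂} (isDTO : IsDecTotalOrder _≡_ _≼_) where

  private
    decTotalOrder : DecTotalOrder a a ℓ₂
    decTotalOrder = record { isDecTotalOrder = isDTO }

    module Sort = Data.List.Sort decTotalOrder
    module Perm≡ = Perm (setoid X)

  sortedListing : ∀ {m} {P : Pred X ℓ} {R : Rel X ℓ} → Symmetric R → (r : Fin m → X) →
                  (∀ i → P (r i)) → (∀ i j → i ≢ j → R (r i) (r j)) →
                  ∃ λ xs → length xs ≡ m × AllPairs _≼_ xs × All P xs × AllPairs R xs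
  sortedListing R-sym r Pr Rr =
      xs
    , trans (↭-length perm) (length-tabulate r)
    , Linked⇒AllPairs (IsDecTotalOrder.trans isDTO) (Sort.sort-↗ (List.tabulate r))
    , Perm≡.All-resp-↭ (subst _) (↭⇒↭ₛ (↭-sym perm)) (All.tabulate⁺ Pr)
    , Perm≡.AllPairs-resp-↭ R-sym (resp₂ _) (↭⇒↭ₛ (↭-sym perm)) (AllPairs.tabulate⁺ (Rr _ _))
    where
      xs = Sort.sort (List.tabulate r)
      perm = Sort.sort-↭ (List.tabulate r)

module Chain {X : Set} {k : ℕ}
  (_∼_ : Fin k → X → Set) (_∼?_ : ∀ b x → Dec (b ∼ x))
  (Ok : X → Set) (_≼_ : Rel X 0ℓ)
  (convex : ∀ {b x y z} → Ok x → Ok y → Ok z → x ≼ y → y ≼ z → b ∼ x → b ∼ z → b ∼ y)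
  where

  SameTrace : X → X → Set
  SameTrace x y = ∀ b → b ∼ x ⇔ b ∼ y

  Separates : Fin k → X → X → Set
  Separates b x y = (b ∼ x × ¬ b ∼ y) ⊎ (¬ b ∼ x × b ∼ y)

  Separated : X → X → Set
  Separated x y = ∃ λ b → Separates b x y

  ≁-sym : Symmetric (λ x y → ¬ SameTrace x y)
  ≁-sym x≁y y∼x = x≁y λ b → mk⇔ (Equivalence.from (y∼x b)) (Equivalence.to (y∼x b))

  separated : ∀ {x y} → ¬ SameTrace x y → Separated x y
  separated {x} {y} x≁y = decidable-stable (any? separates?) λ ¬sep →
    x≁y λ b → mk⇔ (λ b∼x → decidable-stable (b ∼? y) (λ b≁y → ¬sep (b , inj₁ (b∼x , b≁y))))
                  (λ b∼y → decidable-stable (b ∼? x) (λ b≁x → ¬sep (b , inj₂ (b≁x , b∼y))))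
    where
      separates? : ∀ b → Dec (Separates b x y)
      separates? b = (b ∼? x ×-dec ¬? (b ∼? y)) ⊎-dec (¬? (b ∼? x) ×-dec b ∼? y)

  Touches : List X → Fin k → Set
  Touches xs b = Any (b ∼_) xs

  lastOf : X → List X → X
  lastOf u []       = u
  lastOf u (a ∷ xs) = lastOf a xs

  lastOf-∈ : ∀ u xs → lastOf u xs ∈ₗ u ∷ xs
  lastOf-∈ u []       = here refl
  lastOf-∈ u (a ∷ xs) = there (lastOf-∈ a xs)

  EndsEarly : X → List X → Fin k → Set
  EndsEarly u xs b = Touches (u ∷ xs) b × ¬ b ∼ lastOf u xs

  StartsLate : X → List X → Fin k → Set
  StartsLate u xs b = Touches (u ∷ xs) b × ¬ b ∼ u

  touches? : ∀ xs → Decidable (Touches xs)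
  touches? xs b = Any.any? (b ∼?_) xs

  endsEarly? : ∀ u xs → Decidable (EndsEarly u xs)
  endsEarly? u xs b = touches? (u ∷ xs) b ×-dec ¬? (b ∼? lastOf u xs)

  startsLate? : ∀ u xs → Decidable (StartsLate u xs)
  startsLate? u xs b = touches? (u ∷ xs) b ×-dec ¬? (b ∼? u)

  touched : List X → Subset k
  touched xs = toSubset (touches? xs)

  endingEarly : X → List X → Subset k
  endingEarly u xs = toSubset (endsEarly? u xs)

  startingLate : X → List X → Subset k
  startingLate u xs = toSubset (startsLate? u xs)

  touches-next : ∀ {b u a ys} → Ok u → All Ok (a ∷ ys) → u ≼ a → All (a ≼_) ys →
                 b ∼ u → Touches (a ∷ ys) b → b ∼ a
  touches-next _ _ _ _ _ (here b∼a) = b∼a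
  touches-next okᵤ (okₐ ∷ oks) u≼a a≼ys b∼u (there t) =
    All.lookupWith (λ (ok , a≼) → convex okᵤ okₐ ok u≼a a≼ b∼u) (All.zip (oks , a≼ys)) t

  gaps-bound : ∀ u xs → AllPairs _≼_ (u ∷ xs) → All Ok (u ∷ xs) → Linked Separated (u ∷ xs) →
               length xs ≤ ∣ endingEarly u xs ∣ + ∣ startingLate u xs ∣
  gaps-bound u [] _ _ _ = z≤n
  gaps-bound u (a ∷ ys) ((u≼a ∷ _) ∷ sorted@(a≼ys ∷ _)) (okᵤ ∷ oks) ((b , sep) Linked.∷ seps) =
    ≤-<-trans (gaps-bound a ys sorted oks seps) (grow sep)
    where
      next : ∀ {b} → b ∼ u → Touches (a ∷ ys) b → b ∼ a
      next = touches-next okᵤ oks u≼a a≼ys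

      ends⊆ : ∀ {b} → EndsEarly a ys b → EndsEarly u (a ∷ ys) b
      ends⊆ (t , b≁z) = there t , b≁z

      starts⊆ : ∀ {b} → StartsLate a ys b → StartsLate u (a ∷ ys) b
      starts⊆ (t , b≁a) = there t , λ b∼u → b≁a (next b∼u t)

      grow : Separates b u a →
             ∣ endingEarly a ys ∣ + ∣ startingLate a ys ∣ <
             ∣ endingEarly u (a ∷ ys) ∣ + ∣ startingLate u (a ∷ ys) ∣
      grow (inj₁ (b∼u , b≁a)) = +-mono-<-≤
        (∣toSubset∣-mono-< (endsEarly? a ys) (endsEarly? u (a ∷ ys)) ends⊆
          b (here b∼u , b≁a ∘ next b∼u ∘ lose (lastOf-∈ a ys)) (b≁a ∘ next b∼u ∘ proj₁))
        (∣toSubset∣-mono (startsLate? a ys) (startsLate? u (a ∷ ys)) starts⊆)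
      grow (inj₂ (b≁u , b∼a)) = +-mono-≤-<
        (∣toSubset∣-mono (endsEarly? a ys) (endsEarly? u (a ∷ ys)) ends⊆)
        (∣toSubset∣-mono-< (startsLate? a ys) (startsLate? u (a ∷ ys)) starts⊆
          b (there (here b∼a) , b≁u) (λ (_ , b≁a) → b≁a b∼a))

  chain-bound : ∀ u xs → AllPairs _≼_ (u ∷ xs) → All Ok (u ∷ xs) → Linked Separated (u ∷ xs) →
                Separated u (lastOf u xs) → length (u ∷ xs) ≤ 2 * ∣ touched (u ∷ xs) ∣
  chain-bound u xs sorted oks seps (b , sep) = begin
    suc (length xs)                                    ≤⟨ s≤s (gaps-bound u xs sorted oks seps) ⟩
    suc (∣ endingEarly u xs ∣ + ∣ startingLate u xs ∣) ≤⟨ fewer sep ⟩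
    ∣ touched (u ∷ xs) ∣ + ∣ touched (u ∷ xs) ∣        ≡⟨ cong (∣ touched (u ∷ xs) ∣ +_) (sym (+-identityʳ _)) ⟩
    2 * ∣ touched (u ∷ xs) ∣                           ∎
    where
      open ≤-Reasoning
      fewer : Separates b u (lastOf u xs) →
              ∣ endingEarly u xs ∣ + ∣ startingLate u xs ∣ < ∣ touched (u ∷ xs) ∣ + ∣ touched (u ∷ xs) ∣
      fewer (inj₁ (b∼u , _)) = +-mono-≤-<
        (∣toSubset∣-mono (endsEarly? u xs) (touches? (u ∷ xs)) proj₁)
        (∣toSubset∣-mono-< (startsLate? u xs) (touches? (u ∷ xs)) proj₁
          b (here b∼u) (λ (_ , b≁u) → b≁u b∼u))
      fewer (inj₂ (_ , b∼z)) = +-mono-<-≤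
        (∣toSubset∣-mono-< (endsEarly? u xs) (touches? (u ∷ xs)) proj₁
          b (lose (lastOf-∈ u xs) b∼z) (λ (_ , b≁z) → b≁z b∼z))
        (∣toSubset∣-mono (startsLate? u xs) (touches? (u ∷ xs)) proj₁)

  chain-length : ∀ {xs} → AllPairs _≼_ xs → All Ok xs → AllPairs (λ x y → ¬ SameTrace x y) xs →
                 length xs ≤ 1 ⊔ 2 * ∣ touched xs ∣
  chain-length {[]}         _ _ _ = z≤n
  chain-length {u ∷ []}     _ _ _ = m≤m⊔n 1 (2 * ∣ touched (u ∷ []) ∣)
  chain-length {u ∷ a ∷ ys} sorted oks distinct@(u≁ ∷ _) =
    ≤-trans (chain-bound u (a ∷ ys) sorted oks (Linked.map separated (AllPairs⇒Linked distinct))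
                         (separated (All.lookup u≁ (lastOf-∈ a ys))))
            (m≤n⊔m 1 (2 * ∣ touched (u ∷ a ∷ ys) ∣))

module Dimension2 {n : ℕ} {_≺_ : Rel (Fin n) 0ℓ} (poset : IsPoset _≺_)
  {_<₁_ _<₂_ : Rel (Fin n) 0ℓ} (sto₁ : IsStrictTotalOrder _≡_ _<₁_) (sto₂ : IsStrictTotalOrder _≡_ _<₂_)
  (realizer : ∀ x y → (x ≺ y) ⇔ (x <₁ y × x <₂ y))
  where

  private
    module ≺ = IsPoset poset
    module <₁ = IsStrictTotalOrder sto₁
    module <₂ = IsStrictTotalOrder sto₂

  _≤₁_ : Rel (Fin n) 0ℓ
  _≤₁_ = StrictToNonStrict._≤_ _≡_ _<₁_

  ≤₁-isDecTotalOrder : IsDecTotalOrder _≡_ _≤₁_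
  ≤₁-isDecTotalOrder = StrictToNonStrict.isDecTotalOrder _≡_ _<₁_ sto₁

  ≺-intro : ∀ {x y} → x <₁ y → x <₂ y → x ≺ y
  ≺-intro {x} {y} x<₁y x<₂y = Equivalence.from (realizer x y) (x<₁y , x<₂y)

  ≺⇒<₁ : ∀ {x y} → x ≺ y → x <₁ y
  ≺⇒<₁ {x} {y} = proj₁ ∘ Equivalence.to (realizer x y)

  ≺⇒<₂ : ∀ {x y} → x ≺ y → x <₂ y
  ≺⇒<₂ {x} {y} = proj₂ ∘ Equivalence.to (realizer x y)

  _≺?_ : ∀ x y → Dec (x ≺ y)
  x ≺? y = map′ (Equivalence.from (realizer x y)) (Equivalence.to (realizer x y))
                (x <₁.<? y ×-dec x <₂.<? y)

  comparable? : ∀ b x → Dec (InN _≺_ x b)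
  comparable? b x = b ≺? x ⊎-dec x ≺? b

  module OnAntichain {A : Subset n} (antichain : IsAntichain _≺_ A) where

    comparable-∉ : ∀ {a b} → a ∈ A → InN _≺_ a b → b ∉ A
    comparable-∉ a∈A (inj₁ b≺a) b∈A = antichain _ _ b∈A a∈A b≺a
    comparable-∉ a∈A (inj₂ a≺b) b∈A = antichain _ _ a∈A b∈A a≺b

    <₁⇒>₂ : ∀ {a c} → a ∈ A → c ∈ A → a <₁ c → c <₂ a
    <₁⇒>₂ {a} {c} a∈A c∈A a<₁c with <₂.compare a c
    ... | tri< a<₂c _ _ = ⊥-elim (antichain a c a∈A c∈A (≺-intro a<₁c a<₂c))
    ... | tri≈ _ refl _ = ⊥-elim (<₁.irrefl refl a<₁c)
    ... | tri> _ _ c<₂a = c<₂a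

    comparable-convex : ∀ {b x y z} → x ∈ A → y ∈ A → z ∈ A → x ≤₁ y → y ≤₁ z →
                        InN _≺_ x b → InN _≺_ z b → InN _≺_ y b
    comparable-convex _ _ _ (inj₂ refl) _ b∼x _ = b∼x
    comparable-convex _ _ _ _ (inj₂ refl) _ b∼z = b∼z
    comparable-convex x∈A y∈A z∈A (inj₁ x<₁y) (inj₁ y<₁z) (inj₁ b≺x) (inj₁ b≺z) =
      inj₁ (≺-intro (<₁.trans (≺⇒<₁ b≺x) x<₁y) (<₂.trans (≺⇒<₂ b≺z) (<₁⇒>₂ y∈A z∈A y<₁z)))
    comparable-convex x∈A y∈A z∈A (inj₁ x<₁y) (inj₁ y<₁z) (inj₂ x≺b) (inj₂ z≺b) =
      inj₂ (≺-intro (<₁.trans y<₁z (≺⇒<₁ z≺b)) (<₂.trans (<₁⇒>₂ x∈A y∈A x<₁y) (≺⇒<₂ x≺b)))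
    comparable-convex x∈A _ z∈A _ _ (inj₂ x≺b) (inj₁ b≺z) =
      ⊥-elim (antichain _ _ x∈A z∈A (≺.trans x≺b b≺z))
    comparable-convex x∈A _ z∈A _ _ (inj₁ b≺x) (inj₂ z≺b) =
      ⊥-elim (antichain _ _ z∈A x∈A (≺.trans z≺b b≺x))

    open Chain (λ b x → InN _≺_ x b) comparable? (_∈ A) _≤₁_ comparable-convex public

    touched-⊆-∁ : ∀ {xs} → All (_∈ A) xs → touched xs ⊆ ∁ A
    touched-⊆-∁ xs⊆A b∈ =
      x∉p⇒x∈∁p (All.lookupWith comparable-∉ xs⊆A (∈-toSubset⁻ (touches? _) b∈))

lemma3 : (n : ℕ) (_≺_ : Rel (Fin n) 0ℓ) → IsPoset _≺_ → DimAtMost2 _≺_ →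
    (A : Subset n) → IsAntichain _≺_ A → (∃ λ x → x ∉ A) →
    AtMostClasses (SameN _≺_) A (2 * (n ∸ ∣ A ∣))
lemma3 n _≺_ poset (_ , _ , sto₁ , sto₂ , realizer) A antichain (_ , x∉A) m r r∈A r≁ =
  let xs , length-xs , sorted , xs⊆A , distinct = sortedListing ≤₁-isDecTotalOrder ≁-sym r r∈A r≁
  in begin
    m                       ≡⟨ sym length-xs ⟩
    length xs               ≤⟨ chain-length sorted xs⊆A distinct ⟩
    1 ⊔ 2 * ∣ touched xs ∣  ≤⟨ ⊔-lub (≤-trans (x∉p⇒0<n∸∣p∣ x∉A) (m≤n*m _ 2))
                                    (*-monoʳ-≤ 2 (p⊆∁q⇒∣p∣≤n∸∣q∣ (touched-⊆-∁ xs⊆A))) ⟩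
    2 * (n ∸ ∣ A ∣)         ∎
  where
    open Dimension2 poset sto₁ sto₂ realizer
    open OnAntichain antichain
    open ≤-Reasoning
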